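{- For every integer $k\ge 1$: (i) $R_2(2;k) \ge \frac{3}{2}k - O(1)$; (ii) if $q=3$ or $q=4$, then $R_q(2;k)\ge \frac{5}{3}k - O(1)$; (iii) if $q\ge 5$ is a prime power, then $R_q(2;k) \ge 2k - O(1)$. Here the implied constants depend only on $q$.
   Context: For a prime power $q$ and integers $t,k\ge1$, $R_q(t;k)$ is the smallest integer $n$ such that for every coloring of the $1$-dimensional linear subspaces of $\mathbb{F}_q^n$ with $k$ colors there exists a $t$-dimensional linear subspace $U\le\mathbb{F}_q^n$ all of whose $1$-dimensional subspaces receive the same color. -}

module Defs where

open import Level using (0ℓ)
open import Data.Nat using (ℕ; _≥_; _≤_)
open import Data.Nat.Primality using (Prime)
open import Data.Fin using (Fin)
open import Data.Vec using (Vec; map; zipWith)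
open import Data.Product using (Σ; ∃; ∃-syntax; _×_; _,_)
open import Relation.Binary.PropositionalEquality using (_≡_; _≢_)
open import Relation.Nullary using (¬_)
open import Algebra.Bundles using (CommutativeRing)
open import Function.Bundles using (_↔_)

IsPrimePower : ℕ → Set
IsPrimePower q = ∃[ p ] ∃[ e ] (Prime p × e ≥ 1 × q ≡ p Data.Nat.^ e)

record FiniteField (q : ℕ) : Set₁ where
  field
    fieldRing : CommutativeRing 0ℓ 0ℓ
  open CommutativeRing fieldRing public hiding (ring)
  field
    ≈-is-≡    : ∀ {x y} → (x ≈ y) → x ≡ y
    ≡-is-≈    : ∀ {x y} → x ≡ y → x ≈ y
    0≢1       : 0# ≢ 1#
    inverse   : ∀ x → x ≢ 0# → ∃[ y ] (x * y ≡ 1#)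
    card      : Carrier ↔ Fin q

module _ {q : ℕ} (F : FiniteField q) where
  open FiniteField F

  Vector : ℕ → Set
  Vector n = Vec Carrier n

  _·_ : ∀ {n} → Carrier → Vector n → Vector n
  a · v = map (a *_) v

  _⊕_ : ∀ {n} → Vector n → Vector n → Vector n
  u ⊕ v = zipWith _+_ u v

  LinIndep : ∀ {n} → Vector n → Vector n → Set
  LinIndep {n} u v = ∀ a b → (a · u) ⊕ (b · v) ≡ Data.Vec.replicate n 0# → (a ≡ 0# × b ≡ 0#)

  -- A k-coloring of the 1-dimensional subspaces of 𝔽_q^n, represented as a
  -- map on vectors that is constant on each line (value at 0 irrelevant):
  -- the 1-dim subspace spanned by a nonzero v gets colour c v.
  record LineColoring (n k : ℕ) : Set where
    field
      colour    : Vector n → Fin k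
      invariant : ∀ (a : Carrier) (v : Vector n) → a ≢ 0# → colour (a · v) ≡ colour v

  HasMono2 : ∀ {n k} → LineColoring n k → Set
  HasMono2 {n} c = ∃[ u ] ∃[ v ] (LinIndep u v ×
      (∀ a b → ¬ (a ≡ 0# × b ≡ 0#) → LineColoring.colour c ((a · u) ⊕ (b · v)) ≡ LineColoring.colour c u))

  Ramsey2 : ℕ → ℕ → Set
  Ramsey2 n k = ∀ (c : LineColoring n k) → HasMono2 c

  -- The Ramsey property fails at dimension n (n < R_q(2;k)).
  -- "R_q(2;k) ≥ m" unfolds, by definition of R_q(2;k) as the least n with
  -- Ramsey2 n k, to: ¬Ramsey n k for every n < m.
  ¬Ramsey : ℕ → ℕ → Set
  ¬Ramsey n k = ¬ Ramsey2 n k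

{-# OPTIONS --safe #-}
module Submission where

-- The lower bounds come from explicit colourings, defined by recursion on the dimension.
--
-- q ≥ 3: write a vector of F^(2j+3) as (x, y, r) with r ∈ F^(2j+1). Vectors with x = y = 0 keep
-- the colour of r, vectors with x = 0 ≠ y get the new colour j+1, and otherwise r is first
-- translated by x e₁ when the slope y/x is neither 0 nor 1 and then coloured one level down, the
-- new colour j+1 going to a vanishing translate. A monochromatic plane either contains a nonzero
-- vector with x = y = 0, and then the translated tails span a monochromatic plane one level down,
-- or it maps onto F², and then all its points have colour j+1, so all translated tails vanish,
-- which the points of slopes 0, 1 and τ ∉ {0, 1} make impossible. So j+1 colours do not suffice
-- in dimension 2j+1, which gives R_q(2;k) ≥ 2k, hence also part (ii).
--
-- q = 2: a vector (p, r) ∈ F₂³ × F₂^(3j) keeps the colour of r when that colour is not 0, and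
-- otherwise gets 0 or one of two new colours from one of two tables on p, according to whether
-- r = 0. In a monochromatic plane {x, y, x + y} either the three tails span a monochromatic plane
-- one level down, or one of them vanishes and the tables forbid the resulting configuration of
-- heads. So 2j+1 colours do not suffice in dimension 3j. Padding by zeros passes the bounds
-- down to all smaller dimensions.

open import Defs using (FiniteField; IsPrimePower; Vector; LinIndep; LineColoring; Ramsey2; ¬Ramsey)
import Defs
open import Data.Nat as ℕ using (ℕ; zero; suc; _≤_; _<_; z≤n; s≤s)
open import Data.Nat.Properties as ℕ using ()
open import Data.Fin as Fin using (Fin; zero; suc; fromℕ<)
open import Data.Fin.Patterns using (0F; 1F; 2F)
import Data.Fin.Properties as Fin
open import Data.Vec as Vec using (Vec; []; _∷_; replicate; padRight)
import Data.Vec.Properties as Vec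
open import Data.Product using (∃-syntax; _×_; _,_; proj₁; proj₂)
open import Data.Sum using (_⊎_; inj₁; inj₂)
open import Data.Empty using (⊥; ⊥-elim)
open import Data.Bool as Bool using (Bool; true; false; _xor_)
import Data.Bool.Properties as Bool
open import Function using (_∘_)
open import Function.Bundles using (Inverse; Injection)
open import Function.Properties.Inverse using (↔⇒↣)
open import Relation.Binary.Definitions using (DecidableEquality)
open import Relation.Binary.PropositionalEquality
open import Relation.Nullary using (¬_; Dec; yes; no; contradiction)
open import Relation.Nullary.Decidable using (via-injection; map′; _×-dec_; _→-dec_; ¬?; from-yes; toSum)
open import Algebra.Bundles using (CommutativeRing)
import Algebra.Properties.Ring as RingProperties

module FieldProperties {q : ℕ} (F : FiniteField q) where
  open FiniteField F using (Carrier; 0#; 1#; _+_; _*_; -_; ≈-is-≡; ≡-is-≈; 0≢1; inverse; card; fieldRing)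
  private
    module R = FiniteField F
    module P = RingProperties (CommutativeRing.ring fieldRing)

  infix 4 _≟_
  _≟_ : DecidableEquality Carrier
  _≟_ = via-injection (↔⇒↣ card) Fin._≟_

  open import Algebra.Solver.Ring.NaturalCoefficients.Default R.commutativeSemiring public

  *-cancelˡ-≢0 : ∀ {a x y} → a ≢ 0# → a * x ≡ a * y → x ≡ y
  *-cancelˡ-≢0 {a} {x} {y} a≢0 ax≡ay = begin
    x                   ≡⟨ ≈-is-≡ (solve 1 (λ x → x := con 1 :* x) R.refl x) ⟩
    1# * x              ≡⟨ cong (_* x) (sym ab≡1) ⟩
    (a * b) * x         ≡⟨ ≈-is-≡ (solve 3 (λ a b x → (a :* b) :* x := b :* (a :* x)) R.refl a b x) ⟩
    b * (a * x)         ≡⟨ cong (b *_) ax≡ay ⟩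
    b * (a * y)         ≡⟨ ≈-is-≡ (solve 3 (λ a b y → b :* (a :* y) := (a :* b) :* y) R.refl a b y) ⟩
    (a * b) * y         ≡⟨ cong (_* y) ab≡1 ⟩
    1# * y              ≡⟨ ≈-is-≡ (solve 1 (λ y → con 1 :* y := y) R.refl y) ⟩
    y                   ∎
    where
      open ≡-Reasoning
      b = proj₁ (inverse a a≢0)
      ab≡1 = proj₂ (inverse a a≢0)

  a*x≡0 : ∀ a {x} → x ≡ 0# → a * x ≡ 0#
  a*x≡0 a x≡0 = trans (cong (a *_) x≡0) (≈-is-≡ (R.zeroʳ a))

  x*y≡0⇒y≡0 : ∀ {x y} → x ≢ 0# → x * y ≡ 0# → y ≡ 0#
  x*y≡0⇒y≡0 {x} x≢0 xy≡0 = *-cancelˡ-≢0 x≢0 (trans xy≡0 (sym (≈-is-≡ (R.zeroʳ x))))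

  *-≢0 : ∀ {x y} → x ≢ 0# → y ≢ 0# → x * y ≢ 0#
  *-≢0 x≢0 y≢0 xy≡0 = y≢0 (x*y≡0⇒y≡0 x≢0 xy≡0)

  1≢0 : 1# ≢ 0#
  1≢0 = 0≢1 ∘ sym

  -x*y≡-y*x : ∀ x y → (- x) * y ≡ (- y) * x
  -x*y≡-y*x x y = ≈-is-≡ (begin
    (- x) * y  ≈⟨ P.-‿distribˡ-* x y ⟨
    - (x * y)  ≈⟨ R.-‿cong (R.*-comm x y) ⟩
    - (y * x)  ≈⟨ P.-‿distribˡ-* y x ⟩
    (- y) * x  ∎)
    where open import Relation.Binary.Reasoning.Setoid R.setoid

  -y*x+x*y≡0 : ∀ x y → (- y) * x + x * y ≡ 0#
  -y*x+x*y≡0 x y = ≈-is-≡ (begin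
    (- y) * x + x * y    ≈⟨ R.+-cong (P.-‿distribˡ-* y x) (R.*-comm y x) ⟨
    - (y * x) + y * x    ≈⟨ R.-‿inverseˡ (y * x) ⟩
    0#                   ∎)
    where open import Relation.Binary.Reasoning.Setoid R.setoid

  +-cancelʳ : ∀ {x y z} → x + z ≡ y + z → x ≡ y
  +-cancelʳ {x} {y} {z} eq = ≈-is-≡ (P.+-cancelʳ z x y (≡-is-≈ eq))

  kernel-trivial : ∀ {a b a′ b′ α β} → a * b′ ≢ b * a′ →
                   α * a + β * a′ ≡ 0# → α * b + β * b′ ≡ 0# → α ≡ 0# × β ≡ 0#
  kernel-trivial {a} {b} {a′} {b′} {α} {β} det≢0 e₁ e₂ = α≡0 , β≡0
    where
      open ≡-Reasoning
      -- Cramer's rule without subtraction: γ (ab′ − ba′) is a combination of e₁ and e₂ for γ ∈ {α, β}.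
      solved-α : α * (a * b′) ≡ α * (b * a′)
      solved-α = +-cancelʳ (begin
        α * (a * b′) + β * (a′ * b′)
          ≡⟨ ≈-is-≡ (solve 6 (λ α β a b a′ b′ → α :* (a :* b′) :+ β :* (a′ :* b′) := b′ :* (α :* a :+ β :* a′))
                             R.refl α β a b a′ b′) ⟩
        b′ * (α * a + β * a′)         ≡⟨ a*x≡0 b′ e₁ ⟩
        0#                            ≡⟨ a*x≡0 a′ e₂ ⟨
        a′ * (α * b + β * b′)
          ≡⟨ ≈-is-≡ (solve 6 (λ α β a b a′ b′ → a′ :* (α :* b :+ β :* b′) := α :* (b :* a′) :+ β :* (a′ :* b′))
                             R.refl α β a b a′ b′) ⟩
        α * (b * a′) + β * (a′ * b′)  ∎)
      solved-β : β * (a * b′) ≡ β * (b * a′)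
      solved-β = +-cancelʳ (begin
        β * (a * b′) + α * (a * b)
          ≡⟨ ≈-is-≡ (solve 6 (λ α β a b a′ b′ → β :* (a :* b′) :+ α :* (a :* b) := a :* (α :* b :+ β :* b′))
                             R.refl α β a b a′ b′) ⟩
        a * (α * b + β * b′)        ≡⟨ a*x≡0 a e₂ ⟩
        0#                          ≡⟨ a*x≡0 b e₁ ⟨
        b * (α * a + β * a′)
          ≡⟨ ≈-is-≡ (solve 6 (λ α β a b a′ b′ → b :* (α :* a :+ β :* a′) := β :* (b :* a′) :+ α :* (a :* b))
                             R.refl α β a b a′ b′) ⟩
        β * (b * a′) + α * (a * b)  ∎)
      vanishes : ∀ {γ} → γ * (a * b′) ≡ γ * (b * a′) → γ ≡ 0#
      vanishes {γ} e with γ ≟ 0#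
      ... | yes γ≡0 = γ≡0
      ... | no γ≢0 = contradiction (*-cancelˡ-≢0 γ≢0 e) det≢0
      α≡0 = vanishes solved-α
      β≡0 = vanishes solved-β

  third-element : 3 ≤ q → ∃[ τ ] τ ≢ 0# × τ ≢ 1#
  third-element 3≤q =
    let (k , k≢0 , k≢1) = avoid-two 3≤q (to 0#) (to 1#)
    in from k , k≢0 ∘ from≡⇒≡to , k≢1 ∘ from≡⇒≡to
    where
      open Inverse card using (to; from; strictlyInverseˡ)
      from≡⇒≡to : ∀ {k x} → from k ≡ x → k ≡ to x
      from≡⇒≡to {k} refl = sym (strictlyInverseˡ k)
      avoid-two : ∀ {n} → 3 ≤ n → (i j : Fin n) → ∃[ k ] k ≢ i × k ≢ j
      avoid-two (s≤s (s≤s (s≤s _))) = λ where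
        zero          zero          → 1F , (λ ()) , (λ ())
        zero          (suc zero)    → 2F , (λ ()) , (λ ())
        zero          (suc (suc _)) → 1F , (λ ()) , (λ ())
        (suc zero)    zero          → 2F , (λ ()) , (λ ())
        (suc zero)    (suc zero)    → 0F , (λ ()) , (λ ())
        (suc zero)    (suc (suc _)) → 0F , (λ ()) , (λ ())
        (suc (suc _)) zero          → 1F , (λ ()) , (λ ())
        (suc (suc _)) (suc zero)    → 0F , (λ ()) , (λ ())
        (suc (suc _)) (suc (suc _)) → 0F , (λ ()) , (λ ())

  det : Carrier → Carrier → Carrier → Carrier → Carrier
  det x₁ x₂ y₁ y₂ = y₂ * x₁ + (- x₂) * y₁

  det-expansion : ∀ x₁ x₂ y₁ y₂ → (- y₁) * x₂ + x₁ * y₂ ≡ det x₁ x₂ y₁ y₂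
  det-expansion x₁ x₂ y₁ y₂ = begin
    (- y₁) * x₂ + x₁ * y₂  ≡⟨ cong (_+ x₁ * y₂) (-x*y≡-y*x y₁ x₂) ⟩
    (- x₂) * y₁ + x₁ * y₂  ≡⟨ ≈-is-≡ (solve 3 (λ m x₁ y₂ → m :+ x₁ :* y₂ := y₂ :* x₁ :+ m)
                                             R.refl ((- x₂) * y₁) x₁ y₂) ⟩
    y₂ * x₁ + (- x₂) * y₁  ∎
    where open ≡-Reasoning

  -x≡0⇒x≡0 : ∀ {x} → - x ≡ 0# → x ≡ 0#
  -x≡0⇒x≡0 {x} -x≡0 = +-cancelʳ (begin
    x + - x   ≡⟨ ≈-is-≡ (R.-‿inverseʳ x) ⟩
    0#        ≡⟨ -x≡0 ⟨
    - x       ≡⟨ ≈-is-≡ (R.+-identityˡ (- x)) ⟨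
    0# + - x  ∎)
    where open ≡-Reasoning

  swap-nontrivial : ∀ {x y} → ¬ (x ≡ 0# × y ≡ 0#) → ¬ (- y ≡ 0# × x ≡ 0#)
  swap-nontrivial xy≢0 (-y≡0 , x≡0) = xy≢0 (x≡0 , -x≡0⇒x≡0 -y≡0)

  a*0+b*0≡0 : ∀ a b → a * 0# + b * 0# ≡ 0#
  a*0+b*0≡0 a b = ≈-is-≡ (solve 2 (λ a b → a :* con 0 :+ b :* con 0 := con 0) R.refl a b)

  singular-kernel : ∀ {x₁ x₂ y₁ y₂} → det x₁ x₂ y₁ y₂ ≡ 0# →
                    ∃[ a ] ∃[ b ] ¬ (a ≡ 0# × b ≡ 0#) × a * x₁ + b * y₁ ≡ 0# × a * x₂ + b * y₂ ≡ 0#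
  singular-kernel {x₁} {x₂} {y₁} {y₂} det≡0 with x₁ ≟ 0# ×-dec y₁ ≟ 0#
  ... | no row₁≢0 =
    - y₁ , x₁ , swap-nontrivial row₁≢0 , -y*x+x*y≡0 x₁ y₁ , trans (det-expansion x₁ x₂ y₁ y₂) det≡0
  ... | yes (refl , refl) with x₂ ≟ 0# ×-dec y₂ ≟ 0#
  ...   | no row₂≢0 = - y₂ , x₂ , swap-nontrivial row₂≢0 , a*0+b*0≡0 (- y₂) x₂ , -y*x+x*y≡0 x₂ y₂
  ...   | yes (refl , refl) = 1# , 0# , 1≢0 ∘ proj₁ , a*0+b*0≡0 1# 0# , a*0+b*0≡0 1# 0#

  complement : ∀ {a′ b′} → ¬ (a′ ≡ 0# × b′ ≡ 0#) → ∃[ a ] ∃[ b ] a * b′ ≢ b * a′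
  complement {a′} {b′} nontrivial with b′ ≟ 0#
  ... | no b′≢0  = 1# , 0# , λ eq →
    b′≢0 (trans (sym (≈-is-≡ (R.*-identityˡ b′))) (trans eq (≈-is-≡ (R.zeroˡ a′))))
  ... | yes refl = 0# , 1# , λ eq →
    nontrivial (trans (sym (≈-is-≡ (R.*-identityˡ a′))) (trans (sym eq) (≈-is-≡ (R.zeroˡ 0#))) , refl)

module _ {a} {A : Set a} where

  padRight-map : ∀ {m n} (m≤n : m ≤ n) {z : A} (f : A → A) → f z ≡ z → (xs : Vec A m) →
                 padRight m≤n z (Vec.map f xs) ≡ Vec.map f (padRight m≤n z xs)
  padRight-map z≤n       {z} f fz≡z []       = sym (trans (Vec.map-replicate f z _) (cong (replicate _) fz≡z))
  padRight-map (s≤s m≤n)     f fz≡z (x ∷ xs) = cong (f x ∷_) (padRight-map m≤n f fz≡z xs)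

  padRight-zipWith : ∀ {m n} (m≤n : m ≤ n) {z : A} (f : A → A → A) → f z z ≡ z → (xs ys : Vec A m) →
                     padRight m≤n z (Vec.zipWith f xs ys) ≡ Vec.zipWith f (padRight m≤n z xs) (padRight m≤n z ys)
  padRight-zipWith z≤n       {z} f fzz≡z []       []       =
    sym (trans (Vec.zipWith-replicate f z z) (cong (replicate _) fzz≡z))
  padRight-zipWith (s≤s m≤n)     f fzz≡z (x ∷ xs) (y ∷ ys) =
    cong (f x y ∷_) (padRight-zipWith m≤n f fzz≡z xs ys)

  padRight-injective : ∀ {m n} (m≤n : m ≤ n) (z : A) {xs ys : Vec A m} →
                       padRight m≤n z xs ≡ padRight m≤n z ys → xs ≡ ys
  padRight-injective m≤n z {xs} {ys} eq = begin
    xs                                  ≡⟨ Vec.truncate-padRight m≤n z xs ⟨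
    Vec.truncate m≤n (padRight m≤n z xs) ≡⟨ cong (Vec.truncate m≤n) eq ⟩
    Vec.truncate m≤n (padRight m≤n z ys) ≡⟨ Vec.truncate-padRight m≤n z ys ⟩
    ys                                  ∎
    where open ≡-Reasoning

module Vectors {q : ℕ} (F : FiniteField q) where
  open FiniteField F using (Carrier; 0#; 1#; _+_; _*_; ≈-is-≡)
  open FieldProperties F
  private module R = FiniteField F

  infixr 7 _·_
  infixl 6 _⊕_

  _·_ : ∀ {n} → Carrier → Vector F n → Vector F n
  _·_ = Defs._·_ F

  _⊕_ : ∀ {n} → Vector F n → Vector F n → Vector F n
  _⊕_ = Defs._⊕_ F

  0ᵛ : ∀ {n} → Vector F n
  0ᵛ = replicate _ 0#

  infix 4 _≟ᵛ_
  _≟ᵛ_ : ∀ {n} → DecidableEquality (Vector F n)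
  _≟ᵛ_ = Vec.≡-dec _≟_

  combination-combination : ∀ {n} α β a b a′ b′ (u v : Vector F n) →
    α · (a · u ⊕ b · v) ⊕ β · (a′ · u ⊕ b′ · v) ≡ (α * a + β * a′) · u ⊕ (α * b + β * b′) · v
  combination-combination α β a b a′ b′ []      []      = refl
  combination-combination α β a b a′ b′ (x ∷ u) (y ∷ v) = cong₂ _∷_
    (≈-is-≡ (solve 8 (λ α β a b a′ b′ x y → α :* (a :* x :+ b :* y) :+ β :* (a′ :* x :+ b′ :* y)
                                         := (α :* a :+ β :* a′) :* x :+ (α :* b :+ β :* b′) :* y)
                     R.refl α β a b a′ b′ x y))
    (combination-combination α β a b a′ b′ u v)

  0·u≡0 : ∀ {n} (u : Vector F n) → 0# · u ≡ 0ᵛ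
  0·u≡0 []      = refl
  0·u≡0 (x ∷ u) = cong₂ _∷_ (≈-is-≡ (R.zeroˡ x)) (0·u≡0 u)

  a·0≡0 : ∀ {n} a → a · 0ᵛ ≡ 0ᵛ {n}
  a·0≡0 {zero}  a = refl
  a·0≡0 {suc n} a = cong₂ _∷_ (≈-is-≡ (R.zeroʳ a)) (a·0≡0 a)

  1·v≡v : ∀ {n} (v : Vector F n) → 1# · v ≡ v
  1·v≡v []      = refl
  1·v≡v (x ∷ v) = cong₂ _∷_ (≈-is-≡ (R.*-identityˡ x)) (1·v≡v v)

  0⊕w≡w : ∀ {n} (w : Vector F n) → 0ᵛ ⊕ w ≡ w
  0⊕w≡w = Vec.zipWith-identityˡ (≈-is-≡ ∘ R.+-identityˡ)

  w⊕0≡w : ∀ {n} (w : Vector F n) → w ⊕ 0ᵛ ≡ w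
  w⊕0≡w = Vec.zipWith-identityʳ (≈-is-≡ ∘ R.+-identityʳ)

  0·u⊕0·v≡0 : ∀ {n} (u v : Vector F n) → 0# · u ⊕ 0# · v ≡ 0ᵛ
  0·u⊕0·v≡0 u v = trans (cong₂ _⊕_ (0·u≡0 u) (0·u≡0 v)) (0⊕w≡w 0ᵛ)

  1·u⊕0·v≡u : ∀ {n} (u v : Vector F n) → 1# · u ⊕ 0# · v ≡ u
  1·u⊕0·v≡u u v = trans (cong₂ _⊕_ (1·v≡v u) (0·u≡0 v)) (w⊕0≡w u)

  0·u⊕1·v≡v : ∀ {n} (u v : Vector F n) → 0# · u ⊕ 1# · v ≡ v
  0·u⊕1·v≡v u v = trans (cong₂ _⊕_ (0·u≡0 u) (1·v≡v v)) (0⊕w≡w v)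

  1·u⊕1·v≡u⊕v : ∀ {n} (u v : Vector F n) → 1# · u ⊕ 1# · v ≡ u ⊕ v
  1·u⊕1·v≡u⊕v u v = cong₂ _⊕_ (1·v≡v u) (1·v≡v v)

  a·0⊕b·0≡0 : ∀ {n} a b → a · 0ᵛ ⊕ b · 0ᵛ ≡ 0ᵛ {n}
  a·0⊕b·0≡0 a b = trans (cong₂ _⊕_ (a·0≡0 a) (a·0≡0 b)) (0⊕w≡w 0ᵛ)

  a·v≡0⇒v≡0 : ∀ {n a} {v : Vector F n} → a ≢ 0# → a · v ≡ 0ᵛ → v ≡ 0ᵛ
  a·v≡0⇒v≡0 {v = []}    a≢0 _  = refl
  a·v≡0⇒v≡0 {v = x ∷ v} a≢0 eq =
    cong₂ _∷_ (x*y≡0⇒y≡0 a≢0 (Vec.∷-injectiveˡ eq)) (a·v≡0⇒v≡0 a≢0 (Vec.∷-injectiveʳ eq))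

  a·v≡0⇒a≡0 : ∀ {n a} {v : Vector F n} → v ≢ 0ᵛ → a · v ≡ 0ᵛ → a ≡ 0#
  a·v≡0⇒a≡0 {a = a} v≢0 eq with a ≟ 0#
  ... | yes a≡0 = a≡0
  ... | no  a≢0 = contradiction (a·v≡0⇒v≡0 a≢0 eq) v≢0

module Planes {q : ℕ} (F : FiniteField q) where
  open FiniteField F using (0#; 1#; _*_; -_)
  open FieldProperties F using (1≢0; kernel-trivial; -y*x+x*y≡0)
  open Vectors F

  -- A record rather than a function type, so that χ, u, v and c can be inferred from its inhabitants.
  record Monochromatic {n} (χ : Vector F n → ℕ) (u v : Vector F n) (c : ℕ) : Set where
    constructor monochromatic
    field colour≡ : ∀ a b → a · u ⊕ b · v ≢ 0ᵛ → χ (a · u ⊕ b · v) ≡ c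

  open Monochromatic public

  NoMonochromaticPlane : ∀ {n} → (Vector F n → ℕ) → Set
  NoMonochromaticPlane χ = ∀ u v c → LinIndep F u v → ¬ Monochromatic χ u v c

  module _ {n} {χ : Vector F n → ℕ} {u v : Vector F n} {c : ℕ} (mono : Monochromatic χ u v c) where

    Monochromatic-member : ∀ {a b w} → a · u ⊕ b · v ≡ w → w ≢ 0ᵛ → χ w ≡ c
    Monochromatic-member refl = colour≡ mono _ _

    Monochromatic-combination : ∀ a b a′ b′ → Monochromatic χ (a · u ⊕ b · v) (a′ · u ⊕ b′ · v) c
    Monochromatic-combination a b a′ b′ =
      monochromatic λ α β → Monochromatic-member (sym (combination-combination α β a b a′ b′ u v))

    Monochromatic-left : u ≢ 0ᵛ → χ u ≡ c
    Monochromatic-left = Monochromatic-member (1·u⊕0·v≡u u v)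

    Monochromatic-right : v ≢ 0ᵛ → χ v ≡ c
    Monochromatic-right = Monochromatic-member (0·u⊕1·v≡v u v)

    Monochromatic-sum : u ⊕ v ≢ 0ᵛ → χ (u ⊕ v) ≡ c
    Monochromatic-sum = Monochromatic-member (1·u⊕1·v≡u⊕v u v)

  module _ {n} {u v : Vector F n} (li : LinIndep F u v) where

    LinIndep-combination : ∀ {a b a′ b′} → a * b′ ≢ b * a′ →
                           LinIndep F (a · u ⊕ b · v) (a′ · u ⊕ b′ · v)
    LinIndep-combination {a} {b} {a′} {b′} det≢0 α β w≡0 =
      kernel-trivial det≢0 (proj₁ coefficients≡0) (proj₂ coefficients≡0)
      where coefficients≡0 = li _ _ (trans (sym (combination-combination α β a b a′ b′ u v)) w≡0)

    LinIndep⇒left≢0 : u ≢ 0ᵛ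
    LinIndep⇒left≢0 u≡0 = 1≢0 (proj₁ (li 1# 0# (trans (1·u⊕0·v≡u u v) u≡0)))

    LinIndep⇒right≢0 : v ≢ 0ᵛ
    LinIndep⇒right≢0 v≡0 = 1≢0 (proj₂ (li 0# 1# (trans (0·u⊕1·v≡v u v) v≡0)))

    LinIndep⇒sum≢0 : u ⊕ v ≢ 0ᵛ
    LinIndep⇒sum≢0 u⊕v≡0 = 1≢0 (proj₁ (li 1# 1# (trans (1·u⊕1·v≡u⊕v u v) u⊕v≡0)))

  dim1-¬LinIndep : ∀ {x y} → ¬ LinIndep F (x ∷ []) (y ∷ [])
  dim1-¬LinIndep {x} {y} li =
    LinIndep⇒left≢0 li (cong (_∷ []) (proj₂ (li (- y) x (cong (_∷ []) (-y*x+x*y≡0 x y)))))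

  NoMonochromaticSum : ∀ {n} → (Vector F n → ℕ) → Set
  NoMonochromaticSum χ =
    ∀ x y c → x ≢ 0ᵛ → y ≢ 0ᵛ → x ⊕ y ≢ 0ᵛ → χ x ≡ c → χ y ≡ c → χ (x ⊕ y) ≢ c

  no-sum⇒no-plane : ∀ {n} {χ : Vector F n → ℕ} → NoMonochromaticSum χ → NoMonochromaticPlane χ
  no-sum⇒no-plane no-sum u v c li mono =
    no-sum u v c (LinIndep⇒left≢0 li) (LinIndep⇒right≢0 li) (LinIndep⇒sum≢0 li)
      (Monochromatic-left mono (LinIndep⇒left≢0 li)) (Monochromatic-right mono (LinIndep⇒right≢0 li))
      (Monochromatic-sum mono (LinIndep⇒sum≢0 li))

module RamseyProperties {q : ℕ} (F : FiniteField q) where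
  open FiniteField F using (0#; _+_; _*_; ≈-is-≡)
  open Vectors F
  open Planes F
  private module R = FiniteField F

  ¬Ramsey-from-colouring : ∀ {n k} (χ : Vector F n → ℕ) → (∀ v → χ v < k) →
                           (∀ a v → a ≢ 0# → χ (a · v) ≡ χ v) → NoMonochromaticPlane χ → ¬Ramsey F n k
  ¬Ramsey-from-colouring {n} {k} χ χ<k χ-invariant no-mono ramsey =
    let (u , v , li , mono) = ramsey colouring
    in no-mono u v (χ u) li (monochromatic λ a b w≢0 →
         Fin.fromℕ<-injective _ _ (χ<k _) (χ<k u) (mono a b (nontrivial u v w≢0)))
    where
      colouring : LineColoring F n k
      colouring = record
        { colour    = λ v → fromℕ< (χ<k v)
        ; invariant = λ a v a≢0 → Fin.fromℕ<-cong _ _ (χ-invariant a v a≢0) _ _ }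
      nontrivial : ∀ {a b} u v → a · u ⊕ b · v ≢ 0ᵛ → ¬ (a ≡ 0# × b ≡ 0#)
      nontrivial u v w≢0 (refl , refl) = w≢0 (0·u⊕0·v≡0 u v)

  Ramsey2-mono : ∀ {m n k} → m ≤ n → Ramsey2 F m k → Ramsey2 F n k
  Ramsey2-mono {m} {n} {k} m≤n ramsey c =
    let (u , v , li , mono) = ramsey restricted
    in pad u , pad v ,
       (λ a b w≡0 → li a b (padRight-injective m≤n 0#
          (trans (pad-combination a b u v) (trans w≡0 (Vec.padRight-replicate m≤n 0#))))) ,
       (λ a b nontrivial → trans (cong colour (sym (pad-combination a b u v))) (mono a b nontrivial))
    where
      open LineColoring c
      pad : Vector F m → Vector F n
      pad = padRight m≤n 0#
      pad-scale : ∀ a w → pad (a · w) ≡ a · pad w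
      pad-scale a = padRight-map m≤n (a *_) (≈-is-≡ (R.zeroʳ a))
      pad-combination : ∀ a b w w′ → pad (a · w ⊕ b · w′) ≡ a · pad w ⊕ b · pad w′
      pad-combination a b w w′ =
        trans (padRight-zipWith m≤n _+_ (≈-is-≡ (R.+-identityʳ 0#)) (a · w) (b · w′))
              (cong₂ _⊕_ (pad-scale a w) (pad-scale b w′))
      restricted : LineColoring F m k
      restricted = record
        { colour    = colour ∘ pad
        ; invariant = λ a w a≢0 → trans (cong colour (pad-scale a w)) (invariant a (pad w) a≢0) }

  ¬Ramsey-mono : ∀ {m n k} → m ≤ n → ¬Ramsey F n k → ¬Ramsey F m k
  ¬Ramsey-mono m≤n ¬ramsey = ¬ramsey ∘ Ramsey2-mono m≤n

module AtLeastThreeElements {q : ℕ} (F : FiniteField q) where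
  open FiniteField F using (Carrier; 0#; 1#; _+_; _*_; -_; ≈-is-≡)
  open FieldProperties F
  open Vectors F
  open Planes F
  open RamseyProperties F using (¬Ramsey-from-colouring)
  private module R = FiniteField F

  dim : ℕ → ℕ
  dim j = suc (j ℕ.* 2)

  addHead : ∀ {n} → Carrier → Vector F (suc n) → Vector F (suc n)
  addHead x (h ∷ r) = h + x ∷ r

  shift : ∀ {n} → Carrier → Carrier → Vector F (suc n) → Vector F (suc n)
  shift x y r with y ≟ 0# | y ≟ x
  ... | yes _ | _     = r
  ... | no _  | yes _ = r
  ... | no _  | no _  = addHead x r

  colour : ∀ j → Vector F (dim j) → ℕ
  tailColour : ∀ j → Vector F (dim j) → ℕ

  colour zero    _           = 0
  colour (suc j) (x ∷ y ∷ r) with x ≟ 0# | y ≟ 0#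
  ... | yes _ | yes _ = colour j r
  ... | yes _ | no _  = suc j
  ... | no _  | _     = tailColour j (shift x y r)

  tailColour j r with r ≟ᵛ 0ᵛ
  ... | yes _ = suc j
  ... | no _  = colour j r

  shift-slope-0 : ∀ {n x y} (r : Vector F (suc n)) → y ≡ 0# → shift x y r ≡ r
  shift-slope-0 {x = x} {y} r y≡0 with y ≟ 0#
  ... | yes _  = refl
  ... | no y≢0 = contradiction y≡0 y≢0

  shift-slope-1 : ∀ {n x y} (r : Vector F (suc n)) → y ≡ x → shift x y r ≡ r
  shift-slope-1 {x = x} {y} r y≡x with y ≟ 0# | y ≟ x
  ... | yes _ | _      = refl
  ... | no _  | yes _  = refl
  ... | no _  | no y≢x = contradiction y≡x y≢x

  shift-other : ∀ {n x y} (r : Vector F (suc n)) → y ≢ 0# → y ≢ x → shift x y r ≡ addHead x r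
  shift-other {x = x} {y} r y≢0 y≢x with y ≟ 0# | y ≟ x
  ... | yes y≡0 | _      = contradiction y≡0 y≢0
  ... | no _    | yes y≡x = contradiction y≡x y≢x
  ... | no _    | no _   = refl

  shift-⊕ : ∀ {n} x y (r w : Vector F (suc n)) → shift x y (r ⊕ w) ≡ shift x y r ⊕ w
  shift-⊕ x y (h ∷ r) (k ∷ w) with y ≟ 0# | y ≟ x
  ... | yes _ | _     = refl
  ... | no _  | yes _ = refl
  ... | no _  | no _  = cong (_∷ r ⊕ w) (≈-is-≡ (solve 3 (λ h k x → (h :+ k) :+ x := (h :+ x) :+ k) R.refl h k x))

  shift-· : ∀ {n a} x y (r : Vector F (suc n)) → a ≢ 0# → shift (a * x) (a * y) (a · r) ≡ a · shift x y r
  shift-· {a = a} x y r@(h ∷ t) a≢0 with y ≟ 0# | y ≟ x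
  ... | yes y≡0 | _      = shift-slope-0 (a · r) (a*x≡0 a y≡0)
  ... | no _    | yes y≡x = shift-slope-1 (a · r) (cong (a *_) y≡x)
  ... | no y≢0  | no y≢x = trans (shift-other (a · r) (*-≢0 a≢0 y≢0) (y≢x ∘ *-cancelˡ-≢0 a≢0))
                                 (cong (_∷ a · t) (≈-is-≡ (solve 3 (λ a h x → a :* h :+ a :* x := a :* (h :+ x))
                                                                   R.refl a h x)))

  colour-00 : ∀ {j x y} (r : Vector F (dim j)) → x ≡ 0# → y ≡ 0# → colour (suc j) (x ∷ y ∷ r) ≡ colour j r
  colour-00 {x = x} {y} r x≡0 y≡0 with x ≟ 0# | y ≟ 0#
  ... | yes _  | yes _  = refl
  ... | yes _  | no y≢0 = contradiction y≡0 y≢0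
  ... | no x≢0 | _      = contradiction x≡0 x≢0

  colour-0y : ∀ {j x y} (r : Vector F (dim j)) → x ≡ 0# → y ≢ 0# → colour (suc j) (x ∷ y ∷ r) ≡ suc j
  colour-0y {x = x} {y} r x≡0 y≢0 with x ≟ 0# | y ≟ 0#
  ... | yes _  | yes y≡0 = contradiction y≡0 y≢0
  ... | yes _  | no _    = refl
  ... | no x≢0 | _       = contradiction x≡0 x≢0

  colour-x : ∀ {j x y} (r : Vector F (dim j)) → x ≢ 0# →
             colour (suc j) (x ∷ y ∷ r) ≡ tailColour j (shift x y r)
  colour-x {x = x} r x≢0 with x ≟ 0#
  ... | yes x≡0 = contradiction x≡0 x≢0
  ... | no _    = refl

  tailColour-≢0 : ∀ {j} {r : Vector F (dim j)} → r ≢ 0ᵛ → tailColour j r ≡ colour j r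
  tailColour-≢0 {r = r} r≢0 with r ≟ᵛ 0ᵛ
  ... | yes r≡0 = contradiction r≡0 r≢0
  ... | no _    = refl

  colour-≤ : ∀ j (v : Vector F (dim j)) → colour j v ≤ j
  tailColour-≤ : ∀ j (r : Vector F (dim j)) → tailColour j r ≤ suc j

  colour-≤ zero    _           = z≤n
  colour-≤ (suc j) (x ∷ y ∷ r) with x ≟ 0# | y ≟ 0#
  ... | yes _ | yes _ = ℕ.m≤n⇒m≤1+n (colour-≤ j r)
  ... | yes _ | no _  = ℕ.≤-refl
  ... | no _  | _     = tailColour-≤ j (shift x y r)

  tailColour-≤ j r with r ≟ᵛ 0ᵛ
  ... | yes _ = ℕ.≤-refl
  ... | no _  = ℕ.m≤n⇒m≤1+n (colour-≤ j r)

  tailColour-≤⇒≢0 : ∀ {j} {r : Vector F (dim j)} → tailColour j r ≤ j → r ≢ 0ᵛ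
  tailColour-≤⇒≢0 {r = r} tailColour≤j with r ≟ᵛ 0ᵛ
  ... | yes _ = λ _ → ℕ.1+n≰n tailColour≤j
  ... | no r≢0 = r≢0

  tailColour≡suc⇒≡0 : ∀ {j} {r : Vector F (dim j)} → tailColour j r ≡ suc j → r ≡ 0ᵛ
  tailColour≡suc⇒≡0 {j} {r} tailColour≡suc with r ≟ᵛ 0ᵛ
  ... | yes r≡0 = r≡0
  ... | no _    = contradiction (subst (_≤ j) tailColour≡suc (colour-≤ j r)) ℕ.1+n≰n

  colour-· : ∀ j {a} (v : Vector F (dim j)) → a ≢ 0# → colour j (a · v) ≡ colour j v
  tailColour-· : ∀ j {a} (r : Vector F (dim j)) → a ≢ 0# → tailColour j (a · r) ≡ tailColour j r

  colour-· zero    _           _   = refl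
  colour-· (suc j) {a} (x ∷ y ∷ r) a≢0 with x ≟ 0# | y ≟ 0#
  ... | yes x≡0 | yes y≡0 = trans (colour-00 (a · r) (a*x≡0 a x≡0) (a*x≡0 a y≡0)) (colour-· j r a≢0)
  ... | yes x≡0 | no y≢0  = colour-0y (a · r) (a*x≡0 a x≡0) (*-≢0 a≢0 y≢0)
  ... | no x≢0  | _       = begin
    colour (suc j) (a * x ∷ a * y ∷ a · r)        ≡⟨ colour-x (a · r) (*-≢0 a≢0 x≢0) ⟩
    tailColour j (shift (a * x) (a * y) (a · r))  ≡⟨ cong (tailColour j) (shift-· x y r a≢0) ⟩
    tailColour j (a · shift x y r)                ≡⟨ tailColour-· j (shift x y r) a≢0 ⟩
    tailColour j (shift x y r)                    ∎
    where open ≡-Reasoning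

  tailColour-· j {a} r a≢0 with r ≟ᵛ 0ᵛ
  ... | yes refl = trans (cong (tailColour j) (a·0≡0 a)) (tailColour-0ᵛ j)
    where
      tailColour-0ᵛ : ∀ j → tailColour j 0ᵛ ≡ suc j
      tailColour-0ᵛ j with (0ᵛ {dim j}) ≟ᵛ 0ᵛ
      ... | yes _   = refl
      ... | no 0≢0 = contradiction refl 0≢0
  ... | no r≢0 = trans (tailColour-≢0 (r≢0 ∘ a·v≡0⇒v≡0 a≢0)) (colour-· j r a≢0)

  α*z+β*0≡α*z : ∀ α β z → α * z + β * 0# ≡ α * z
  α*z+β*0≡α*z α β z = ≈-is-≡ (solve 3 (λ α β z → α :* z :+ β :* con 0 := α :* z) R.refl α β z)

  colour-off-kernel : ∀ {j x y α} β (rz rw : Vector F (dim j)) → x ≢ 0# → α ≢ 0# →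
                      colour (suc j) (α · (x ∷ y ∷ rz) ⊕ β · (0# ∷ 0# ∷ rw))
                        ≡ tailColour j (α · shift x y rz ⊕ β · rw)
  colour-off-kernel {j} {x} {y} {α} β rz rw x≢0 α≢0 = begin
    colour (suc j) (α · (x ∷ y ∷ rz) ⊕ β · (0# ∷ 0# ∷ rw))
      ≡⟨ colour-x _ (*-≢0 α≢0 x≢0 ∘ trans (sym (α*z+β*0≡α*z α β x))) ⟩
    tailColour j (shift (α * x + β * 0#) (α * y + β * 0#) (α · rz ⊕ β · rw))
      ≡⟨ cong₂ (λ s t → tailColour j (shift s t (α · rz ⊕ β · rw)))
               (α*z+β*0≡α*z α β x) (α*z+β*0≡α*z α β y) ⟩
    tailColour j (shift (α * x) (α * y) (α · rz ⊕ β · rw))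
      ≡⟨ cong (tailColour j) (shift-⊕ _ _ (α · rz) (β · rw)) ⟩
    tailColour j (shift (α * x) (α * y) (α · rz) ⊕ β · rw)
      ≡⟨ cong (λ r → tailColour j (r ⊕ β · rw)) (shift-· x y rz α≢0) ⟩
    tailColour j (α · shift x y rz ⊕ β · rw)
      ∎
    where open ≡-Reasoning

  plane-through-axis : ∀ {j y c} {rz rw : Vector F (dim j)} → y ≢ 0# →
                       LinIndep F (0# ∷ y ∷ rz) (0# ∷ 0# ∷ rw) →
                       ¬ Monochromatic (colour (suc j)) (0# ∷ y ∷ rz) (0# ∷ 0# ∷ rw) c
  plane-through-axis {j} {y} {c} {rz} {rw} y≢0 li mono = ℕ.1+n≰n (subst (_≤ j) colour-rw≡suc (colour-≤ j rw))
    where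
      colour-rw≡suc : colour j rw ≡ suc j
      colour-rw≡suc = begin
        colour j rw                    ≡⟨ colour-00 rw refl refl ⟨
        colour (suc j) (0# ∷ 0# ∷ rw)  ≡⟨ Monochromatic-right mono (LinIndep⇒right≢0 li) ⟩
        c                              ≡⟨ Monochromatic-left mono (y≢0 ∘ Vec.∷-injectiveˡ ∘ Vec.∷-injectiveʳ) ⟨
        colour (suc j) (0# ∷ y ∷ rz)   ≡⟨ colour-0y rz refl y≢0 ⟩
        suc j                          ∎
        where open ≡-Reasoning

  module _ {j} (no-mono : NoMonochromaticPlane (colour j)) where

    plane-in-kernel : ∀ {c} {rz rw : Vector F (dim j)} → LinIndep F (0# ∷ 0# ∷ rz) (0# ∷ 0# ∷ rw) →
                      ¬ Monochromatic (colour (suc j)) (0# ∷ 0# ∷ rz) (0# ∷ 0# ∷ rw) c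
    plane-in-kernel {c} {rz} {rw} li mono = no-mono rz rw c
      (λ α β w≡0 → li α β (cong₂ _∷_ (a*0+b*0≡0 α β) (cong₂ _∷_ (a*0+b*0≡0 α β) w≡0)))
      (monochromatic λ α β w≢0 → trans (sym (colour-00 _ (a*0+b*0≡0 α β) (a*0+b*0≡0 α β)))
                                        (colour≡ mono α β (w≢0 ∘ Vec.∷-injectiveʳ ∘ Vec.∷-injectiveʳ)))

    plane-off-kernel : ∀ {x y c} {rz rw : Vector F (dim j)} → x ≢ 0# →
                       LinIndep F (x ∷ y ∷ rz) (0# ∷ 0# ∷ rw) →
                       ¬ Monochromatic (colour (suc j)) (x ∷ y ∷ rz) (0# ∷ 0# ∷ rw) c
    plane-off-kernel {x} {y} {c} {rz} {rw} x≢0 li mono = no-mono r₀ rw c li′ (monochromatic colour-r₀rw)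
      where
        r₀ = shift x y rz
        rw≢0 : rw ≢ 0ᵛ
        rw≢0 rw≡0 = LinIndep⇒right≢0 li (cong (λ r → 0# ∷ 0# ∷ r) rw≡0)
        colour-rw : colour j rw ≡ c
        colour-rw = trans (sym (colour-00 rw refl refl)) (Monochromatic-right mono (LinIndep⇒right≢0 li))
        c≤j : c ≤ j
        c≤j = subst (_≤ j) colour-rw (colour-≤ j rw)
        tailColour≡c : ∀ {α} β → α ≢ 0# → tailColour j (α · r₀ ⊕ β · rw) ≡ c
        tailColour≡c {α} β α≢0 = trans (sym (colour-off-kernel β rz rw x≢0 α≢0))
          (colour≡ mono α β (*-≢0 α≢0 x≢0 ∘ trans (sym (α*z+β*0≡α*z α β x)) ∘ Vec.∷-injectiveˡ))
        combination≢0 : ∀ {α} β → α ≢ 0# → α · r₀ ⊕ β · rw ≢ 0ᵛ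
        combination≢0 β α≢0 = tailColour-≤⇒≢0 (subst (_≤ j) (sym (tailColour≡c β α≢0)) c≤j)
        vanishing-r₀ : ∀ β → 0# · r₀ ⊕ β · rw ≡ β · rw
        vanishing-r₀ β = trans (cong (_⊕ β · rw) (0·u≡0 r₀)) (0⊕w≡w (β · rw))
        li′ : LinIndep F r₀ rw
        li′ α β w≡0 with α ≟ 0#
        ... | yes refl = refl , a·v≡0⇒a≡0 rw≢0 (trans (sym (vanishing-r₀ β)) w≡0)
        ... | no α≢0   = contradiction w≡0 (combination≢0 β α≢0)
        colour-r₀rw : ∀ α β → α · r₀ ⊕ β · rw ≢ 0ᵛ → colour j (α · r₀ ⊕ β · rw) ≡ c
        colour-r₀rw α β w≢0 with α ≟ 0#
        ... | yes refl = trans (cong (colour j) (vanishing-r₀ β)) (trans (colour-· j rw β≢0) colour-rw)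
          where
            β≢0 : β ≢ 0#
            β≢0 refl = w≢0 (0·u⊕0·v≡0 r₀ rw)
        ... | no α≢0   = trans (sym (tailColour-≢0 (combination≢0 β α≢0))) (tailColour≡c β α≢0)

    degenerate-plane : ∀ {x y c} {rz rw : Vector F (dim j)} → LinIndep F (x ∷ y ∷ rz) (0# ∷ 0# ∷ rw) →
                       ¬ Monochromatic (colour (suc j)) (x ∷ y ∷ rz) (0# ∷ 0# ∷ rw) c
    degenerate-plane {x} {y} li with x ≟ 0# | y ≟ 0#
    ... | yes refl | yes refl = plane-in-kernel li
    ... | yes refl | no y≢0   = plane-through-axis y≢0 li
    ... | no x≢0   | _        = plane-off-kernel x≢0 li

  full-plane-tails : ∀ {j d c} {rp rg : Vector F (dim j)} → d ≢ 0# →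
                     Monochromatic (colour (suc j)) (d ∷ 0# ∷ rp) (0# ∷ d ∷ rg) c →
                     ∀ s → shift d (s * d) (1# · rp ⊕ s · rg) ≡ 0ᵛ
  full-plane-tails {j} {d} {c} {rp} {rg} d≢0 mono s = tailColour≡suc⇒≡0 (begin
    tailColour j (shift d (s * d) (1# · rp ⊕ s · rg))
      ≡⟨ cong₂ (λ x y → tailColour j (shift x y (1# · rp ⊕ s · rg))) head₁ head₂ ⟨
    tailColour j (shift (1# * d + s * 0#) (1# * 0# + s * d) (1# · rp ⊕ s · rg))
      ≡⟨ colour-x _ (d≢0 ∘ trans (sym head₁)) ⟨
    colour (suc j) (1# · (d ∷ 0# ∷ rp) ⊕ s · (0# ∷ d ∷ rg))
      ≡⟨ colour≡ mono 1# s (d≢0 ∘ trans (sym head₁) ∘ Vec.∷-injectiveˡ) ⟩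
    c
      ≡⟨ Monochromatic-right mono (d≢0 ∘ Vec.∷-injectiveˡ ∘ Vec.∷-injectiveʳ) ⟨
    colour (suc j) (0# ∷ d ∷ rg)
      ≡⟨ colour-0y rg refl d≢0 ⟩
    suc j
      ∎)
    where
      open ≡-Reasoning
      head₁ : 1# * d + s * 0# ≡ d
      head₁ = ≈-is-≡ (solve 2 (λ d s → con 1 :* d :+ s :* con 0 := d) R.refl d s)
      head₂ : 1# * 0# + s * d ≡ s * d
      head₂ = ≈-is-≡ (solve 2 (λ d s → con 1 :* con 0 :+ s :* d := s :* d) R.refl d s)

  -- Of the slopes 0, 1 and τ, only τ translates the tail, which the vanishing of all tails forbids.
  full-plane : ∀ {τ} → τ ≢ 0# → τ ≢ 1# → ∀ {j d c} {rp rg : Vector F (dim j)} → d ≢ 0# →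
               ¬ Monochromatic (colour (suc j)) (d ∷ 0# ∷ rp) (0# ∷ d ∷ rg) c
  full-plane {τ} τ≢0 τ≢1 {j} {d} {c} {rp} {rg} d≢0 mono = d≢0 d≡0
    where
      tail≡0 = full-plane-tails d≢0 mono
      rp≡0 : rp ≡ 0ᵛ
      rp≡0 = begin
        rp                                     ≡⟨ 1·u⊕0·v≡u rp rg ⟨
        1# · rp ⊕ 0# · rg                      ≡⟨ shift-slope-0 _ (≈-is-≡ (R.zeroˡ d)) ⟨
        shift d (0# * d) (1# · rp ⊕ 0# · rg)   ≡⟨ tail≡0 0# ⟩
        0ᵛ                                     ∎
        where open ≡-Reasoning
      rg≡0 : rg ≡ 0ᵛ
      rg≡0 = a·v≡0⇒v≡0 1≢0 (begin
        1# · rg                                ≡⟨ 0⊕w≡w (1# · rg) ⟨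
        0ᵛ ⊕ 1# · rg                           ≡⟨ cong (λ r → r ⊕ 1# · rg) (trans (cong (1# ·_) rp≡0) (a·0≡0 1#)) ⟨
        1# · rp ⊕ 1# · rg                      ≡⟨ shift-slope-1 _ (≈-is-≡ (R.*-identityˡ d)) ⟨
        shift d (1# * d) (1# · rp ⊕ 1# · rg)   ≡⟨ tail≡0 1# ⟩
        0ᵛ                                     ∎)
        where open ≡-Reasoning
      τd≢d : τ * d ≢ d
      τd≢d τd≡d = τ≢1 (*-cancelˡ-≢0 d≢0
        (trans (≈-is-≡ (R.*-comm d τ)) (trans τd≡d (sym (≈-is-≡ (R.*-identityʳ d))))))
      d≡0 : d ≡ 0#
      d≡0 = begin
        d       ≡⟨ ≈-is-≡ (R.+-identityˡ d) ⟨
        0# + d  ≡⟨ Vec.∷-injectiveˡ (begin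
          addHead d 0ᵛ                         ≡⟨ cong (addHead d) (a·0⊕b·0≡0 1# τ) ⟨
          addHead d (1# · 0ᵛ ⊕ τ · 0ᵛ)         ≡⟨ cong₂ (λ r r′ → addHead d (1# · r ⊕ τ · r′)) rp≡0 rg≡0 ⟨
          addHead d (1# · rp ⊕ τ · rg)         ≡⟨ shift-other _ (*-≢0 τ≢0 d≢0) τd≢d ⟨
          shift d (τ * d) (1# · rp ⊕ τ · rg)   ≡⟨ tail≡0 τ ⟩
          0ᵛ                                   ∎) ⟩
        0#      ∎
        where open ≡-Reasoning

  no-monochromatic-plane : ∀ {τ} → τ ≢ 0# → τ ≢ 1# → ∀ j → NoMonochromaticPlane (colour j)
  no-monochromatic-plane τ≢0 τ≢1 zero    (x ∷ []) (y ∷ []) c li _ = dim1-¬LinIndep li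
  no-monochromatic-plane τ≢0 τ≢1 (suc j) u@(x₁ ∷ x₂ ∷ ru) v@(y₁ ∷ y₂ ∷ rv) c li mono
    with det x₁ x₂ y₁ y₂ ≟ 0#
  ... | no det≢0 = full-plane τ≢0 τ≢1 det≢0
        (subst₂ (λ P G → Monochromatic (colour (suc j)) P G c) P≡ G≡
                (Monochromatic-combination mono y₂ (- x₂) (- y₁) x₁))
    where
      P≡ : y₂ · u ⊕ (- x₂) · v ≡ det x₁ x₂ y₁ y₂ ∷ 0# ∷ y₂ · ru ⊕ (- x₂) · rv
      P≡ = cong (λ t → det x₁ x₂ y₁ y₂ ∷ t ∷ y₂ · ru ⊕ (- x₂) · rv)
                (trans (≈-is-≡ (R.+-comm _ _)) (-y*x+x*y≡0 y₂ x₂))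
      G≡ : (- y₁) · u ⊕ x₁ · v ≡ 0# ∷ det x₁ x₂ y₁ y₂ ∷ (- y₁) · ru ⊕ x₁ · rv
      G≡ = cong₂ (λ s t → s ∷ t ∷ (- y₁) · ru ⊕ x₁ · rv)
                 (-y*x+x*y≡0 x₁ y₁) (det-expansion x₁ x₂ y₁ y₂)
  ... | yes det≡0 =
    let (a′ , b′ , nontrivial , k₁ , k₂) = singular-kernel det≡0
        (a , b , independent) = complement nontrivial
        W≡ : a′ · u ⊕ b′ · v ≡ 0# ∷ 0# ∷ a′ · ru ⊕ b′ · rv
        W≡ = cong₂ (λ s t → s ∷ t ∷ a′ · ru ⊕ b′ · rv) k₁ k₂
    in degenerate-plane (no-monochromatic-plane τ≢0 τ≢1 j)
         (subst (LinIndep F (a · u ⊕ b · v)) W≡ (LinIndep-combination li independent))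
         (subst (λ W → Monochromatic (colour (suc j)) (a · u ⊕ b · v) W c) W≡
                (Monochromatic-combination mono a b a′ b′))

  ¬Ramsey-dim : 3 ≤ q → ∀ j → ¬Ramsey F (dim j) (suc j)
  ¬Ramsey-dim 3≤q j =
    let (τ , τ≢0 , τ≢1) = third-element 3≤q
    in ¬Ramsey-from-colouring (colour j) (s≤s ∘ colour-≤ j) (λ a v → colour-· j v)
                              (no-monochromatic-plane τ≢0 τ≢1 j)

module TwoElements (F : FiniteField 2) where
  open FiniteField F using (Carrier; 0#; 1#; _+_; _*_; ≈-is-≡; card)
  open FieldProperties F
  open Vectors F
  open Planes F
  open RamseyProperties F using (¬Ramsey-from-colouring)
  open Injection (↔⇒↣ card) using (to; injective)
  private module R = FiniteField F

  0-or-1 : ∀ x → x ≡ 0# ⊎ x ≡ 1#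
  0-or-1 x with to x Fin.≟ to 0# | to x Fin.≟ to 1#
  ... | yes e | _     = inj₁ (injective e)
  ... | no _  | yes e = inj₂ (injective e)
  ... | no x≢0 | no x≢1 = ⊥-elim (third (to x) (to 0#) (to 1#) x≢0 x≢1 (R.0≢1 ∘ injective))
    where
      third : (i j k : Fin 2) → i ≢ j → i ≢ k → j ≢ k → ⊥
      third zero       zero       _          i≢j _   _   = i≢j refl
      third (suc zero) (suc zero) _          i≢j _   _   = i≢j refl
      third zero       (suc zero) zero       _   i≢k _   = i≢k refl
      third (suc zero) zero       (suc zero) _   i≢k _   = i≢k refl
      third _          zero       zero       _   _   j≢k = j≢k refl
      third _          (suc zero) (suc zero) _   _   j≢k = j≢k refl

  1+1≡0 : 1# + 1# ≡ 0#
  1+1≡0 with 0-or-1 (1# + 1#)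
  ... | inj₁ 1+1≡0 = 1+1≡0
  ... | inj₂ 1+1≡1 = contradiction (+-cancelʳ (trans 1+1≡1 (sym (≈-is-≡ (R.+-identityˡ 1#))))) 1≢0

  x+x≡0 : ∀ x → x + x ≡ 0#
  x+x≡0 x = begin
    x + x           ≡⟨ ≈-is-≡ (solve 1 (λ x → x :+ x := (con 1 :+ con 1) :* x) R.refl x) ⟩
    (1# + 1#) * x   ≡⟨ cong (_* x) 1+1≡0 ⟩
    0# * x          ≡⟨ ≈-is-≡ (R.zeroˡ x) ⟩
    0#              ∎
    where open ≡-Reasoning

  u⊕v≡0⇒u≡v : ∀ {n} {u v : Vector F n} → u ⊕ v ≡ 0ᵛ → u ≡ v
  u⊕v≡0⇒u≡v {u = []}    {[]}    _  = refl
  u⊕v≡0⇒u≡v {u = x ∷ u} {y ∷ v} eq = cong₂ _∷_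
    (+-cancelʳ (trans (Vec.∷-injectiveˡ eq) (sym (x+x≡0 y))))
    (u⊕v≡0⇒u≡v (Vec.∷-injectiveʳ eq))

  toBool : Carrier → Bool
  toBool x with x ≟ 0#
  ... | yes _ = false
  ... | no _  = true

  toBool-0# : toBool 0# ≡ false
  toBool-0# with 0# ≟ 0#
  ... | yes _  = refl
  ... | no 0≢0 = contradiction refl 0≢0

  toBool-1# : toBool 1# ≡ true
  toBool-1# with 1# ≟ 0#
  ... | yes 1≡0 = contradiction 1≡0 1≢0
  ... | no _    = refl

  toBool-+ : ∀ x y → toBool (x + y) ≡ toBool x xor toBool y
  toBool-+ x y with 0-or-1 x | 0-or-1 y
  ... | inj₁ refl | inj₁ refl rewrite ≈-is-≡ (R.+-identityˡ 0#) | toBool-0#             = refl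
  ... | inj₁ refl | inj₂ refl rewrite ≈-is-≡ (R.+-identityˡ 1#) | toBool-0# | toBool-1# = refl
  ... | inj₂ refl | inj₁ refl rewrite ≈-is-≡ (R.+-identityʳ 1#) | toBool-0# | toBool-1# = refl
  ... | inj₂ refl | inj₂ refl rewrite 1+1≡0 | toBool-0# | toBool-1#                     = refl

  toBool≡false⇒≡0 : ∀ {x} → toBool x ≡ false → x ≡ 0#
  toBool≡false⇒≡0 {x} eq with x ≟ 0#
  ... | yes x≡0 = x≡0
  ... | no _    = contradiction eq λ ()

  Pattern : ℕ → Set
  Pattern = Vec Bool

  infixl 6 _⊻_
  _⊻_ : ∀ {n} → Pattern n → Pattern n → Pattern n
  _⊻_ = Vec.zipWith _xor_

  0ᵖ : ∀ {n} → Pattern n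
  0ᵖ = replicate _ false

  infix 4 _≟ᵖ_
  _≟ᵖ_ : ∀ {n} → DecidableEquality (Pattern n)
  _≟ᵖ_ = Vec.≡-dec Bool._≟_

  ⊻-comm : ∀ {n} (p q : Pattern n) → p ⊻ q ≡ q ⊻ p
  ⊻-comm = Vec.zipWith-comm Bool.xor-comm

  p⊻q⊻q≡p : ∀ {n} (p q : Pattern n) → p ⊻ q ⊻ q ≡ p
  p⊻q⊻q≡p []      []      = refl
  p⊻q⊻q≡p (a ∷ p) (b ∷ q) = cong₂ _∷_
    (trans (Bool.xor-assoc a b b) (trans (cong (a xor_) (Bool.xor-same b)) (Bool.xor-identityʳ a)))
    (p⊻q⊻q≡p p q)

  bits : ∀ {n} → Vector F n → Pattern n
  bits = Vec.map toBool

  bits-⊕ : ∀ {n} (u v : Vector F n) → bits (u ⊕ v) ≡ bits u ⊻ bits v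
  bits-⊕ []      []      = refl
  bits-⊕ (x ∷ u) (y ∷ v) = cong₂ _∷_ (toBool-+ x y) (bits-⊕ u v)

  bits≡0⇒≡0 : ∀ {n} {v : Vector F n} → bits v ≡ 0ᵖ → v ≡ 0ᵛ
  bits≡0⇒≡0 {v = []}    _  = refl
  bits≡0⇒≡0 {v = x ∷ v} eq =
    cong₂ _∷_ (toBool≡false⇒≡0 (Vec.∷-injectiveˡ eq)) (bits≡0⇒≡0 (Vec.∷-injectiveʳ eq))

  all-Bool? : ∀ {P : Bool → Set} → (∀ b → Dec (P b)) → Dec (∀ b → P b)
  all-Bool? P? =
    map′ (λ (f , t) → λ where false → f ; true → t) (λ h → h false , h true) (P? false ×-dec P? true)

  all-Pattern? : ∀ {P : Pattern 3 → Set} → (∀ p → Dec (P p)) → Dec (∀ p → P p)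
  all-Pattern? P? = map′ (λ h → λ where (a ∷ b ∷ c ∷ []) → h a b c) (λ h a b c → h (a ∷ b ∷ c ∷ []))
                         (all-Bool? λ a → all-Bool? λ b → all-Bool? λ c → P? (a ∷ b ∷ c ∷ []))

  Symbol : Set
  Symbol = Fin 3

  -- σ₀ p is the symbol of a vector with head p and zero tail, σ₁ p that of one whose nonzero tail has
  -- colour 0. The proof uses only the two properties of these tables stated next, decided by evaluation.
  σ₀ σ₁ : Pattern 3 → Symbol
  σ₀ (false ∷ false ∷ false ∷ []) = 0F
  σ₀ (false ∷ false ∷ true  ∷ []) = 1F
  σ₀ (false ∷ true  ∷ false ∷ []) = 1F
  σ₀ (false ∷ true  ∷ true  ∷ []) = 2F
  σ₀ (true  ∷ false ∷ false ∷ []) = 1F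
  σ₀ (true  ∷ false ∷ true  ∷ []) = 2F
  σ₀ (true  ∷ true  ∷ false ∷ []) = 0F
  σ₀ (true  ∷ true  ∷ true  ∷ []) = 2F
  σ₁ (false ∷ false ∷ false ∷ []) = 0F
  σ₁ (false ∷ false ∷ true  ∷ []) = 1F
  σ₁ (false ∷ true  ∷ false ∷ []) = 2F
  σ₁ (false ∷ true  ∷ true  ∷ []) = 2F
  σ₁ (true  ∷ false ∷ false ∷ []) = 0F
  σ₁ (true  ∷ false ∷ true  ∷ []) = 0F
  σ₁ (true  ∷ true  ∷ false ∷ []) = 1F
  σ₁ (true  ∷ true  ∷ true  ∷ []) = 0F

  σ₀-no-monochromatic-line : ∀ p q → p ≢ 0ᵖ → q ≢ 0ᵖ → p ⊻ q ≢ 0ᵖ → ¬ (σ₀ p ≡ σ₀ q × σ₀ q ≡ σ₀ (p ⊻ q))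
  σ₀-no-monochromatic-line = from-yes (all-Pattern? λ p → all-Pattern? λ q →
    ¬? (p ≟ᵖ 0ᵖ) →-dec ¬? (q ≟ᵖ 0ᵖ) →-dec ¬? (p ⊻ q ≟ᵖ 0ᵖ) →-dec
    ¬? (σ₀ p Fin.≟ σ₀ q ×-dec σ₀ q Fin.≟ σ₀ (p ⊻ q)))

  σ₀σ₁-no-monochromatic-line : ∀ p q → p ≢ 0ᵖ → ¬ (σ₀ p ≡ σ₁ q × σ₁ q ≡ σ₁ (p ⊻ q))
  σ₀σ₁-no-monochromatic-line = from-yes (all-Pattern? λ p → all-Pattern? λ q →
    ¬? (p ≟ᵖ 0ᵖ) →-dec ¬? (σ₀ p Fin.≟ σ₁ q ×-dec σ₁ q Fin.≟ σ₁ (p ⊻ q)))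

  symbolColour : ℕ → Symbol → ℕ
  symbolColour j 0F = 0
  symbolColour j 1F = suc (j ℕ.* 2)
  symbolColour j 2F = suc (suc (j ℕ.* 2))

  symbolColour-injective : ∀ j {s t} → symbolColour j s ≡ symbolColour j t → s ≡ t
  symbolColour-injective j {0F} {0F} _ = refl
  symbolColour-injective j {1F} {1F} _ = refl
  symbolColour-injective j {2F} {2F} _ = refl
  symbolColour-injective j {0F} {1F} ()
  symbolColour-injective j {0F} {2F} ()
  symbolColour-injective j {1F} {0F} ()
  symbolColour-injective j {2F} {0F} ()
  symbolColour-injective j {1F} {2F} e = contradiction (sym (ℕ.suc-injective e)) ℕ.1+n≢n
  symbolColour-injective j {2F} {1F} e = contradiction (ℕ.suc-injective e) ℕ.1+n≢n

  symbolColour-≤ : ∀ j s → symbolColour j s ≤ suc j ℕ.* 2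
  symbolColour-≤ j 0F = z≤n
  symbolColour-≤ j 1F = ℕ.n≤1+n _
  symbolColour-≤ j 2F = ℕ.≤-refl

  colour : ∀ j → Vector F (j ℕ.* 3) → ℕ
  extend : ∀ j → Pattern 3 → Vector F (j ℕ.* 3) → ℕ

  colour zero    _               = 0
  colour (suc j) (a ∷ b ∷ c ∷ r) = extend j (bits (a ∷ b ∷ c ∷ [])) r

  extend j p r with r ≟ᵛ 0ᵛ | colour j r
  ... | yes _ | _     = symbolColour j (σ₀ p)
  ... | no _  | zero  = symbolColour j (σ₁ p)
  ... | no _  | suc k = suc k

  -- Inverts extend j p on nonzero tails (lower-extend): extend adds only 0 and colours above j * 2.
  lower : ℕ → ℕ → ℕ
  lower j c with c ℕ.≤? j ℕ.* 2
  ... | yes _ = c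
  ... | no _  = 0

  colour-≤ : ∀ j v → colour j v ≤ j ℕ.* 2
  extend-≤ : ∀ j p r → extend j p r ≤ suc j ℕ.* 2

  colour-≤ zero    _               = z≤n
  colour-≤ (suc j) (a ∷ b ∷ c ∷ r) = extend-≤ j _ r

  extend-≤ j p r with r ≟ᵛ 0ᵛ | colour j r | colour-≤ j r
  ... | yes _ | _     | _   = symbolColour-≤ j (σ₀ p)
  ... | no _  | zero  | _   = symbolColour-≤ j (σ₁ p)
  ... | no _  | suc k | k<j = ℕ.m≤n⇒m≤1+n (ℕ.m≤n⇒m≤1+n k<j)

  lower-≤ : ∀ {j c} → c ≤ j ℕ.* 2 → lower j c ≡ c
  lower-≤ {j} {c} c≤ with c ℕ.≤? j ℕ.* 2
  ... | yes _  = refl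
  ... | no c≰ = contradiction c≤ c≰

  lower-> : ∀ {j c} → j ℕ.* 2 < c → lower j c ≡ 0
  lower-> {j} {c} c> with c ℕ.≤? j ℕ.* 2
  ... | yes c≤ = contradiction c≤ (ℕ.<⇒≱ c>)
  ... | no _   = refl

  lower-symbolColour : ∀ j s → lower j (symbolColour j s) ≡ 0
  lower-symbolColour j 0F = lower-≤ {j} z≤n
  lower-symbolColour j 1F = lower-> (ℕ.n<1+n _)
  lower-symbolColour j 2F = lower-> (ℕ.n≤1+n _)

  lower-extend : ∀ {j p} {r : Vector F (j ℕ.* 3)} → r ≢ 0ᵛ → lower j (extend j p r) ≡ colour j r
  lower-extend {j} {p} {r} r≢0 with r ≟ᵛ 0ᵛ | colour j r | colour-≤ j r
  ... | yes r≡0 | _     | _   = contradiction r≡0 r≢0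
  ... | no _    | zero  | _   = lower-symbolColour j (σ₁ p)
  ... | no _    | suc k | k<j = lower-≤ k<j

  extend-0ᵛ : ∀ j p → extend j p 0ᵛ ≡ symbolColour j (σ₀ p)
  extend-0ᵛ j p with (0ᵛ {j ℕ.* 3}) ≟ᵛ 0ᵛ | colour j 0ᵛ
  ... | yes _  | _ = refl
  ... | no 0≢0 | _ = contradiction refl 0≢0

  extend-colour-0 : ∀ {j p} {r : Vector F (j ℕ.* 3)} → r ≢ 0ᵛ → colour j r ≡ 0 →
                    extend j p r ≡ symbolColour j (σ₁ p)
  extend-colour-0 {j} {p} {r} r≢0 colour≡0 with r ≟ᵛ 0ᵛ | colour j r
  ... | yes r≡0 | _    = contradiction r≡0 r≢0
  ... | no _    | zero = refl

  same-symbol : ∀ {j c s t} → symbolColour j s ≡ c → symbolColour j t ≡ c → s ≡ t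
  same-symbol {j} s≡c t≡c = symbolColour-injective j (trans s≡c (sym t≡c))

  zero-tail-case : ∀ {j c p₀ p₁ p₂} {r : Vector F (j ℕ.* 3)} → p₀ ≢ 0ᵖ → p₀ ⊻ p₁ ≡ p₂ →
                (r ≡ 0ᵛ → p₁ ≢ 0ᵖ × p₂ ≢ 0ᵖ) →
                extend j p₀ 0ᵛ ≡ c → extend j p₁ r ≡ c → extend j p₂ r ≢ c
  -- Testing toSum (r ≟ᵛ 0ᵛ) rather than r ≟ᵛ 0ᵛ keeps with-abstraction out of the unfolded
  -- extend in the types of e₀, e₁, e₂.
  zero-tail-case {j} {c} {p₀} {p₁} {r = r} p₀≢0 refl nonzero e₀ e₁ e₂ with toSum (r ≟ᵛ 0ᵛ)
  ... | inj₁ refl = σ₀-no-monochromatic-line p₀ p₁ p₀≢0 (proj₁ (nonzero refl)) (proj₂ (nonzero refl))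
                      (same-symbol (σ₀≡c e₀) (σ₀≡c e₁) , same-symbol (σ₀≡c e₁) (σ₀≡c e₂))
    where
      σ₀≡c : ∀ {p} → extend j p 0ᵛ ≡ c → symbolColour j (σ₀ p) ≡ c
      σ₀≡c {p} = trans (sym (extend-0ᵛ j p))
  ... | inj₂ r≢0  = σ₀σ₁-no-monochromatic-line p₀ p₁ p₀≢0
                      (same-symbol (trans (sym (extend-0ᵛ j p₀)) e₀) (σ₁≡c e₁) , same-symbol (σ₁≡c e₁) (σ₁≡c e₂))
    where
      colour-r≡0 : colour j r ≡ 0
      colour-r≡0 = begin
        colour j r                         ≡⟨ lower-extend r≢0 ⟨
        lower j (extend j p₁ r)            ≡⟨ cong (lower j) (trans e₁ (sym e₀)) ⟩
        lower j (extend j p₀ 0ᵛ)           ≡⟨ cong (lower j) (extend-0ᵛ j p₀) ⟩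
        lower j (symbolColour j (σ₀ p₀))   ≡⟨ lower-symbolColour j (σ₀ p₀) ⟩
        0                                  ∎
        where open ≡-Reasoning
      σ₁≡c : ∀ {p} → extend j p r ≡ c → symbolColour j (σ₁ p) ≡ c
      σ₁≡c = trans (sym (extend-colour-0 r≢0 colour-r≡0))

  head≢0 : ∀ {n} {h : Vector F 3} {r : Vector F n} → h Vec.++ r ≢ 0ᵛ → r ≡ 0ᵛ → bits h ≢ 0ᵖ
  head≢0 h++r≢0 r≡0 bits≡0 = h++r≢0 (cong₂ Vec._++_ (bits≡0⇒≡0 bits≡0) r≡0)

  no-monochromatic-sum : ∀ j → NoMonochromaticSum (colour j)
  no-monochromatic-sum zero    [] _ _ x≢0 _ _ _ _ _ = x≢0 refl
  no-monochromatic-sum (suc j) (a ∷ b ∷ c ∷ rx) (a′ ∷ b′ ∷ c′ ∷ ry) C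
                       x≢0 y≢0 x⊕y≢0 χx≡C χy≡C χx⊕y≡C =
    by-tails (rx ≟ᵛ 0ᵛ) (ry ≟ᵛ 0ᵛ) (rx ⊕ ry ≟ᵛ 0ᵛ)
    where
      hx = a ∷ b ∷ c ∷ []
      hy = a′ ∷ b′ ∷ c′ ∷ []
      px = bits hx
      py = bits hy
      χsum≡C : extend j (px ⊻ py) (rx ⊕ ry) ≡ C
      χsum≡C = subst (λ p → extend j p (rx ⊕ ry) ≡ C) (bits-⊕ hx hy) χx⊕y≡C
      px≢0 : rx ≡ 0ᵛ → px ≢ 0ᵖ
      px≢0 = head≢0 {h = hx} x≢0
      py≢0 : ry ≡ 0ᵛ → py ≢ 0ᵖ
      py≢0 = head≢0 {h = hy} y≢0
      px⊻py≢0 : rx ⊕ ry ≡ 0ᵛ → px ⊻ py ≢ 0ᵖ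
      px⊻py≢0 s≡0 = subst (_≢ 0ᵖ) (bits-⊕ hx hy) (head≢0 {h = hx ⊕ hy} x⊕y≢0 s≡0)
      extend≡C : ∀ {p r r′} → r ≡ r′ → extend j p r ≡ C → extend j p r′ ≡ C
      extend≡C {p} r≡r′ = subst (λ r → extend j p r ≡ C) r≡r′
      lower-C : ∀ {p r} → r ≢ 0ᵛ → extend j p r ≡ C → colour j r ≡ lower j C
      lower-C r≢0 e = trans (sym (lower-extend r≢0)) (cong (lower j) e)
      by-tails : Dec (rx ≡ 0ᵛ) → Dec (ry ≡ 0ᵛ) → Dec (rx ⊕ ry ≡ 0ᵛ) → ⊥
      by-tails (yes rx≡0) _ _ =
        zero-tail-case (px≢0 rx≡0) refl (λ ry≡0 → py≢0 ry≡0 , px⊻py≢0 (trans s≡ry ry≡0))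
          (extend≡C rx≡0 χx≡C) χy≡C (extend≡C s≡ry χsum≡C)
        where s≡ry = trans (cong (_⊕ ry) rx≡0) (0⊕w≡w ry)
      by-tails _ (yes ry≡0) _ =
        zero-tail-case (py≢0 ry≡0) (⊻-comm py px) (λ rx≡0 → px≢0 rx≡0 , px⊻py≢0 (trans s≡rx rx≡0))
          (extend≡C ry≡0 χy≡C) χx≡C (extend≡C s≡rx χsum≡C)
        where s≡rx = trans (cong (rx ⊕_) ry≡0) (w⊕0≡w rx)
      by-tails _ _ (yes s≡0) =
        zero-tail-case (px⊻py≢0 s≡0) (p⊻q⊻q≡p px py) (λ ry≡0 → py≢0 ry≡0 , px≢0 (trans rx≡ry ry≡0))
          (extend≡C s≡0 χsum≡C) χy≡C (extend≡C rx≡ry χx≡C)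
        where rx≡ry = u⊕v≡0⇒u≡v s≡0
      by-tails (no rx≢0) (no ry≢0) (no s≢0) =
        no-monochromatic-sum j rx ry (lower j C) rx≢0 ry≢0 s≢0
          (lower-C rx≢0 χx≡C) (lower-C ry≢0 χy≡C) (lower-C s≢0 χsum≡C)

  ¬Ramsey-dim : ∀ j {k} → j ℕ.* 2 < k → ¬Ramsey F (j ℕ.* 3) k
  ¬Ramsey-dim j 2j<k = ¬Ramsey-from-colouring (colour j) (λ v → ℕ.≤-<-trans (colour-≤ j v) 2j<k) invariant
                                               (no-sum⇒no-plane (no-monochromatic-sum j))
    where
      invariant : ∀ a v → a ≢ 0# → colour j (a · v) ≡ colour j v
      invariant a v a≢0 with 0-or-1 a
      ... | inj₁ a≡0  = contradiction a≡0 a≢0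
      ... | inj₂ refl = cong (colour j) (1·v≡v v)

open import Data.Nat using (_+_; _*_; _≥_)
open ℕ.≤-Reasoning

ceiling-thirds : ∀ n → ∃[ j ] n ≤ j * 3 × j * 3 ≤ n + 2
ceiling-thirds 0 = 0 , z≤n , z≤n
ceiling-thirds 1 = 1 , s≤s z≤n , ℕ.≤-refl
ceiling-thirds 2 = 1 , s≤s (s≤s z≤n) , ℕ.n≤1+n 3
ceiling-thirds (suc (suc (suc n))) =
  let (j , n≤3j , 3j≤n+2) = ceiling-thirds n in suc j , s≤s (s≤s (s≤s n≤3j)) , s≤s (s≤s (s≤s 3j≤n+2))

¬Ramsey-F₂ : (F : FiniteField 2) → ∀ {n k} → 2 * n + 4 < 3 * k → ¬Ramsey F n k
¬Ramsey-F₂ F {n} {k} 2n+4<3k =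
  let (j , n≤3j , 3j≤n+2) = ceiling-thirds n
      6j<3k = begin-strict
        3 * (j * 2)  ≡⟨ ℕ.*-comm 3 (j * 2) ⟩
        j * 2 * 3    ≡⟨ ℕ.*-assoc j 2 3 ⟩
        j * 6        ≡⟨ ℕ.*-assoc j 3 2 ⟨
        j * 3 * 2    ≡⟨ ℕ.*-comm (j * 3) 2 ⟩
        2 * (j * 3)  ≤⟨ ℕ.*-monoʳ-≤ 2 3j≤n+2 ⟩
        2 * (n + 2)  ≡⟨ ℕ.*-distribˡ-+ 2 n 2 ⟩
        2 * n + 4    <⟨ 2n+4<3k ⟩
        3 * k        ∎
  in RamseyProperties.¬Ramsey-mono F n≤3j (TwoElements.¬Ramsey-dim F j (ℕ.*-cancelˡ-< 3 (j * 2) k 6j<3k))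

¬Ramsey-≥3 : ∀ {q} (F : FiniteField q) → 3 ≤ q → ∀ {n k} → n < 2 * k → ¬Ramsey F n k
¬Ramsey-≥3 F 3≤q {n} {zero}  ()
¬Ramsey-≥3 F 3≤q {n} {suc j} n<2k =
  RamseyProperties.¬Ramsey-mono F (ℕ.s≤s⁻¹ (subst (n <_) (ℕ.*-comm 2 (suc j)) n<2k))
                                  (AtLeastThreeElements.¬Ramsey-dim F 3≤q j)

3n<5k⇒n<2k : ∀ {n k} → 3 * n < 5 * k → n < 2 * k
3n<5k⇒n<2k {n} {k} 3n<5k = ℕ.*-cancelˡ-< 3 n (2 * k) (begin-strict
  3 * n        <⟨ 3n<5k ⟩
  5 * k        ≤⟨ ℕ.*-monoˡ-≤ k (ℕ.n≤1+n 5) ⟩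
  6 * k        ≡⟨ ℕ.*-assoc 3 2 k ⟩
  3 * (2 * k)  ∎)

lemma5p1 :
    -- (i) q = 2 : R_2(2;k) ≥ (3/2)k − C, i.e. every n with 2n + 2C < 3k is below R
    (∃[ C ] ∀ (F : FiniteField 2) (k : ℕ) → k ≥ 1 →
        ∀ n → 2 * n + 2 * C < 3 * k → ¬Ramsey F n k)
    ×
    -- (ii) q ∈ {3,4} : R_q(2;k) ≥ (5/3)k − C
    (∀ (q : ℕ) → (q ≡ 3 ⊎ q ≡ 4) → ∃[ C ] ∀ (F : FiniteField q) (k : ℕ) → k ≥ 1 →
        ∀ n → 3 * n + 3 * C < 5 * k → ¬Ramsey F n k)
    ×
    -- (iii) q ≥ 5 a prime power : R_q(2;k) ≥ 2k − C
    (∀ (q : ℕ) → q ≥ 5 → IsPrimePower q → ∃[ C ] ∀ (F : FiniteField q) (k : ℕ) → k ≥ 1 →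
        ∀ n → n + C < 2 * k → ¬Ramsey F n k)
-- Unused hypotheses: k ≥ 1 (for k = 0 the inequality on n already fails) and IsPrimePower q
-- (a field F with q elements is given).
lemma5p1 =
  (2 , λ F k _ n → ¬Ramsey-F₂ F) ,
  (λ q q≡3⊎4 → 0 , λ F k _ n 3n<5k →
     ¬Ramsey-≥3 F (q≡3⊎4⇒3≤q q≡3⊎4) (3n<5k⇒n<2k {n} {k} (subst (_< 5 * k) (ℕ.+-identityʳ (3 * n)) 3n<5k))) ,
  (λ q 5≤q _ → 0 , λ F k _ n n<2k →
     ¬Ramsey-≥3 F (ℕ.≤-trans (ℕ.m≤n+m 3 2) 5≤q) (subst (_< 2 * k) (ℕ.+-identityʳ n) n<2k))
  where
    q≡3⊎4⇒3≤q : ∀ {q} → q ≡ 3 ⊎ q ≡ 4 → 3 ≤ q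
    q≡3⊎4⇒3≤q (inj₁ refl) = ℕ.≤-refl
    q≡3⊎4⇒3≤q (inj₂ refl) = ℕ.n≤1+n 3
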